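{- Let $n\ge 2k$. If $F$ and $F'$ are strong sets in a $k$-uniform MLCIF $\mathcal{F}$ on $[n]$, then $\iota(F)=\iota(F')$.
   Context: For $G=\{y_1<\dots<y_k\}$, $F=\{x_1<\dots<x_k\}$ in $\binom{[n]}{k}$, write $G\leq_{\mathrm{LC}} F$ if $y_i\le x_i$ for all $i$. A $k$-uniform MLCIF on $[n]$ is a family $\mathcal{F}\subseteq\binom{[n]}{k}$ that is intersecting, closed under $\leq_{\mathrm{LC}}$-smaller sets, and maximal under inclusion among such families. For $i\in[k]$ let $Z_i:=[i,2i-1]\cup[n-k+i+1,n]$. For $F\in\mathcal{F}$, the index $\iota(F)$ is the smallest $i\in[k]$ with $F\leq_{\mathrm{LC}} Z_i$ (such an $i$ always exists when $n \ge 2k$). A set $F\in\mathcal{F}$ is a strong set in $\mathcal{F}$ if $|F\cap[2k+1,n]|=k-\iota(F)$. -}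

module Defs where

open import Data.Nat using (ℕ; zero; suc; _+_; _*_; _∸_; _≤_; _<_; _≤?_; _<ᵇ_)
open import Data.Bool using (if_then_else_)
open import Data.Fin as Fin using (Fin; toℕ)
open import Data.Vec using (Vec; lookup; tabulate; count)
open import Data.Vec.Relation.Binary.Pointwise.Inductive using (Pointwise)
open import Data.Vec.Membership.Propositional using (_∈_)
open import Data.Product using (_×_; ∃; Σ)
open import Relation.Nullary using (¬_)
open import Level using (suc; zero) renaming (_⊔_ to _⊔ˡ_)

-- A k-subset of [n] = {1,...,n} is represented by the strictly increasing
-- vector of its elements  x₁ < x₂ < ... < x_k, all in [1,n].
IsKSet : (n k : ℕ) → Vec ℕ k → Set
IsKSet n k F =
  ((i j : Fin k) → i Fin.< j → lookup F i < lookup F j) ×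
  ((i : Fin k) → 1 ≤ lookup F i × lookup F i ≤ n)

_≤LC_ : {k : ℕ} → Vec ℕ k → Vec ℕ k → Set
G ≤LC F = Pointwise _≤_ G F

-- Z_i = [i, 2i-1] ∪ [n-k+i+1, n], listed increasingly.
-- Its (j+1)-th element (j : Fin k, 0-based) is  i + j  if j < i, and n - k + j + 1 otherwise.
Z : (n k i : ℕ) → Vec ℕ k
Z n k i = tabulate (λ (j : Fin k) →
  if toℕ j <ᵇ i then i + toℕ j else (n ∸ k) + toℕ j + 1)

Family : ℕ → Set₁
Family k = Vec ℕ k → Set

IsFamilyOn : (n k : ℕ) → Family k → Set
IsFamilyOn n k 𝓕 = ∀ F → 𝓕 F → IsKSet n k F

Intersecting : {k : ℕ} → Family k → Set
Intersecting 𝓕 = ∀ F G → 𝓕 F → 𝓕 G → ∃ λ x → x ∈ F × x ∈ G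

LCClosed : (n k : ℕ) → Family k → Set
LCClosed n k 𝓕 = ∀ F G → 𝓕 F → IsKSet n k G → G ≤LC F → 𝓕 G

IsLCIF : (n k : ℕ) → Family k → Set
IsLCIF n k 𝓕 = IsFamilyOn n k 𝓕 × Intersecting 𝓕 × LCClosed n k 𝓕

IsMLCIF : (n k : ℕ) → Family k → Set₁
IsMLCIF n k 𝓕 =
  IsLCIF n k 𝓕 ×
  ((𝓖 : Family k) → IsLCIF n k 𝓖 → (∀ F → 𝓕 F → 𝓖 F) → ∀ F → 𝓖 F → 𝓕 F)

IsIndex : (n k : ℕ) → Vec ℕ k → ℕ → Set
IsIndex n k F i =
  1 ≤ i × i ≤ k × F ≤LC Z n k i ×
  (∀ j → 1 ≤ j → j < i → ¬ (F ≤LC Z n k j))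

-- |F ∩ [2k+1, n]|  (elements of F are already ≤ n)
countAbove2k : (k : ℕ) → Vec ℕ k → ℕ
countAbove2k k F = count (λ x → (2 * k + 1) ≤? x) F

open import Relation.Binary.PropositionalEquality using (_≡_)
IsStrong : (n k : ℕ) → Family k → Vec ℕ k → Set
IsStrong n k 𝓕 F =
  𝓕 F × ∃ λ i → IsIndex n k F i × countAbove2k k F ≡ k ∸ i

module Submission where

-- If F is strong of index i, then F dominates (in ≤LC) the set
-- {1, 3, …, 2i−1} ∪ [2k+1, 3k−i], and every k-set of index i' dominates
-- {2, 4, …, 2i'−2} ∪ [2i'−1, k+i'−1].  By left-compression both sets lie in
-- the family, and for i < i' they are disjoint (odd versus even below 2i'−1,
-- everything else separated by 2k), contradicting intersection.

open import Defs
open import Data.Nat using (ℕ; zero; suc; _+_; _*_; _∸_; _≤_; _<_; _≤?_; _<ᵇ_; z≤n; s≤s; s≤s⁻¹; z<s)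
open import Data.Nat.Properties
open import Data.Bool using (true; false; if_then_else_)
open import Data.Fin as Fin using (Fin; toℕ; fromℕ<)
open import Data.Fin.Properties using (toℕ-fromℕ; toℕ-fromℕ<; toℕ-inject₁; toℕ<n; toℕ≤pred[n])
open import Data.Vec using (Vec; _∷_; []; lookup; tabulate; count)
open import Data.Vec.Properties using (lookup∘tabulate; count≤n)
import Data.Vec.Relation.Binary.Pointwise.Inductive as Pointwise
open import Data.Vec.Relation.Binary.Pointwise.Extensional using (ext; extensional⇒inductive)
import Data.Vec.Relation.Unary.Any.Properties as Any
open import Data.Product using (_×_; _,_; proj₁; proj₂)
open import Data.Empty using (⊥-elim)
open import Function using (_∘_)
open import Relation.Binary.Core using (_Preserves_⟶_)
open import Relation.Binary.PropositionalEquality using (_≡_; _≢_; refl; sym; trans; cong; subst; subst₂)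
open import Relation.Nullary using (¬_; yes; no; contradiction)
open import Relation.Nullary.Reflects using (ofʸ; ofⁿ)
open import Relation.Unary using (Decidable)

2*m≡m+m : ∀ m → 2 * m ≡ m + m
2*m≡m+m m = cong (m +_) (+-identityʳ m)

m+m≢1+n+n : ∀ m n → m + m ≢ suc (n + n)
m+m≢1+n+n m n eq = even≢odd m n (trans (2*m≡m+m m) (trans eq (cong suc (sym (2*m≡m+m n)))))

2k+1≡1+k+k : ∀ k → 2 * k + 1 ≡ suc (k + k)
2k+1≡1+k+k k = trans (+-comm (2 * k) 1) (cong suc (2*m≡m+m k))

-- Opaque so that c, f and g are inferred from goals instead of being unfolded away.
opaque
  piecewise : ℕ → (ℕ → ℕ) → (ℕ → ℕ) → ℕ → ℕ
  piecewise c f g p = if p <ᵇ c then f p else g p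

opaque
  unfolding piecewise

  piecewise-elim : ∀ {c f g} (P : ℕ → Set) p → (p < c → P (f p)) → (c ≤ p → P (g p)) →
                   P (piecewise c f g p)
  piecewise-elim {c} P p below above with p <ᵇ c | <ᵇ-reflects-< p c
  ... | true  | ofʸ p<c = below p<c
  ... | false | ofⁿ p≮c = above (≮⇒≥ p≮c)

  lookup-Z : ∀ n k i (j : Fin k) →
             lookup (Z n k i) j ≡ piecewise i (i +_) (λ q → n ∸ k + q + 1) (toℕ j)
  lookup-Z n k i j = lookup∘tabulate _ j

module _ {c : ℕ} {f g : ℕ → ℕ} where

  piecewise-below : ∀ {p} → p < c → piecewise c f g p ≡ f p
  piecewise-below {p} p<c =
    piecewise-elim (_≡ f p) p (λ _ → refl) (λ c≤p → contradiction p<c (≤⇒≯ c≤p))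

  piecewise-preserves-< : f Preserves _<_ ⟶ _<_ →
                          (∀ {p q} → c ≤ p → p < q → g p < g q) →
                          (∀ {p q} → p < c → c ≤ q → f p < g q) →
                          piecewise c f g Preserves _<_ ⟶ _<_
  piecewise-preserves-< f-< g-< f<g {p} {q} p<q =
    piecewise-elim (_< piecewise c f g q) p
      (λ p<c → piecewise-elim (f p <_) q (λ _ → f-< p<q) (f<g p<c))
      (λ c≤p → piecewise-elim (g p <_) q
        (λ q<c → ⊥-elim (<-asym (≤-<-trans c≤p p<q) q<c))
        (λ _ → g-< c≤p p<q))

≤LC-lookup : ∀ {k} {G F : Vec ℕ k} → (∀ j → lookup G j ≤ lookup F j) → G ≤LC F
≤LC-lookup G≤F = extensional⇒inductive (ext G≤F)

≤LC-Z⇒lookup≤ : ∀ {n k i} {F : Vec ℕ k} → F ≤LC Z n k i →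
                ∀ p → toℕ p < i → lookup F p ≤ i + toℕ p
≤LC-Z⇒lookup≤ {n} {k} {i} {F} F≤Z p p<i = begin
  lookup F p                                          ≤⟨ Pointwise.lookup F≤Z p ⟩
  lookup (Z n k i) p                                  ≡⟨ lookup-Z n k i p ⟩
  piecewise i (i +_) (λ q → n ∸ k + q + 1) (toℕ p)   ≡⟨ piecewise-below p<i ⟩
  i + toℕ p                                           ∎
  where open ≤-Reasoning

Increasing : ∀ {k} → Vec ℕ k → Set
Increasing {k} F = (a b : Fin k) → a Fin.< b → lookup F a < lookup F b

increasing-tail : ∀ {k x} {xs : Vec ℕ k} → Increasing (x ∷ xs) → Increasing xs
increasing-tail inc a b = inc (Fin.suc a) (Fin.suc b) ∘ s≤s

increasing-gap : ∀ {k} (F : Vec ℕ k) → Increasing F →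
                 ∀ a b d → toℕ a + d ≡ toℕ b → lookup F a + d ≤ lookup F b
increasing-gap (x ∷ xs) inc Fin.zero Fin.zero d refl = ≤-reflexive (+-identityʳ x)
increasing-gap (x ∷ []) inc Fin.zero (Fin.suc ()) d
increasing-gap (x ∷ y ∷ ys) inc Fin.zero (Fin.suc b) d refl = begin
  x + suc (toℕ b)              ≡⟨ +-suc x (toℕ b) ⟩
  suc x + toℕ b                ≤⟨ +-monoˡ-≤ (toℕ b) (inc Fin.zero (Fin.suc Fin.zero) (s≤s z≤n)) ⟩
  y + toℕ b                    ≤⟨ increasing-gap (y ∷ ys) (increasing-tail inc) Fin.zero b (toℕ b) refl ⟩
  lookup (y ∷ ys) b            ∎
  where open ≤-Reasoning
increasing-gap (x ∷ xs) inc (Fin.suc a) (Fin.suc b) d eq =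
  increasing-gap xs (increasing-tail inc) a b d (suc-injective eq)

kSet-lookup≤ : ∀ {n k} {F : Vec ℕ k} → IsKSet n k F → k ≤ n →
               ∀ j → lookup F j ≤ n ∸ k + toℕ j + 1
kSet-lookup≤ {n} {suc k} {F} (inc , bounded) k≤n j = +-cancelʳ-≤ e _ _ (begin
  lookup F j + e                 ≤⟨ increasing-gap F inc j (Fin.fromℕ k) e
                                      (trans j+e≡k (sym (toℕ-fromℕ k))) ⟩
  lookup F (Fin.fromℕ k)         ≤⟨ proj₂ (bounded (Fin.fromℕ k)) ⟩
  n                              ≡⟨ sym (m∸n+n≡m k≤n) ⟩
  n ∸ suc k + suc k              ≡⟨ cong (λ m → n ∸ suc k + suc m) (sym j+e≡k) ⟩
  n ∸ suc k + (1 + toℕ j + e)    ≡⟨ cong (λ m → n ∸ suc k + (m + e)) (+-comm 1 (toℕ j)) ⟩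
  n ∸ suc k + (toℕ j + 1 + e)    ≡⟨ sym (+-assoc (n ∸ suc k) (toℕ j + 1) e) ⟩
  n ∸ suc k + (toℕ j + 1) + e    ≡⟨ cong (_+ e) (sym (+-assoc (n ∸ suc k) (toℕ j) 1)) ⟩
  n ∸ suc k + toℕ j + 1 + e      ∎)
  where
  open ≤-Reasoning
  e = k ∸ toℕ j
  j+e≡k : toℕ j + e ≡ k
  j+e≡k = m+[n∸m]≡n (toℕ≤pred[n] j)

lookup≤1+2p⇒≤LC-Z : ∀ {n k} {F : Vec ℕ k} → IsKSet n k F → k ≤ n →
                    ∀ p → lookup F p ≤ suc (toℕ p + toℕ p) → F ≤LC Z n k (suc (toℕ p))
lookup≤1+2p⇒≤LC-Z {n} {k} {F} kSet@(inc , _) k≤n p Fp≤ = ≤LC-lookup λ j →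
  subst (lookup F j ≤_) (sym (lookup-Z n k i j))
    (piecewise-elim (lookup F j ≤_) (toℕ j) (below j) (λ _ → kSet-lookup≤ {F = F} kSet k≤n j))
  where
  i = suc (toℕ p)
  below : ∀ j → toℕ j < i → lookup F j ≤ i + toℕ j
  below j j<i = +-cancelʳ-≤ d _ _ (begin
    lookup F j + d               ≤⟨ increasing-gap F inc j p d j+d≡p ⟩
    lookup F p                   ≤⟨ Fp≤ ⟩
    suc (toℕ p + toℕ p)          ≡⟨ cong (λ m → suc (toℕ p + m)) (sym j+d≡p) ⟩
    suc (toℕ p + (toℕ j + d))    ≡⟨ cong suc (sym (+-assoc (toℕ p) (toℕ j) d)) ⟩
    i + toℕ j + d                ∎)
    where
    open ≤-Reasoning
    d = toℕ p ∸ toℕ j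
    j+d≡p : toℕ j + d ≡ toℕ p
    j+d≡p = m+[n∸m]≡n (s≤s⁻¹ j<i)

module _ {n k i} {F : Vec ℕ k} (kSet : IsKSet n k F) (k≤n : k ≤ n) (index : IsIndex n k F i) where

  index⇒2+2p≤ : ∀ p → suc (toℕ p) < i → suc (suc (toℕ p + toℕ p)) ≤ lookup F p
  index⇒2+2p≤ p p+1<i with lookup F p ≤? suc (toℕ p + toℕ p)
  ... | yes Fp≤ = contradiction (lookup≤1+2p⇒≤LC-Z kSet k≤n p Fp≤)
                                (proj₂ (proj₂ (proj₂ index)) _ (s≤s z≤n) p+1<i)
  ... | no Fp≰ = ≰⇒> Fp≰

  index⇒1+2p≤ : ∀ p → toℕ p < i → suc (toℕ p + toℕ p) ≤ lookup F p
  index⇒1+2p≤ Fin.zero _ = proj₁ (proj₂ kSet Fin.zero)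
  index⇒1+2p≤ (Fin.suc q) q+1<i = begin
    suc (toℕ (Fin.suc q) + toℕ (Fin.suc q))  ≡⟨ cong (suc ∘ suc) (+-suc (toℕ q) (toℕ q)) ⟩
    suc (suc (suc (toℕ q + toℕ q)))          ≡⟨ cong (λ m → suc (suc (suc (m + m)))) (sym q′≡q) ⟩
    suc (suc (suc (toℕ q′ + toℕ q′)))        ≤⟨ s≤s (index⇒2+2p≤ q′ (subst (λ m → suc m < i) (sym q′≡q) q+1<i)) ⟩
    suc (lookup F q′)                        ≤⟨ proj₁ kSet q′ (Fin.suc q) (s≤s (≤-reflexive q′≡q)) ⟩
    lookup F (Fin.suc q)                     ∎
    where
    open ≤-Reasoning
    q′ = Fin.inject₁ q
    q′≡q = toℕ-inject₁ q

count<∸ : ∀ {a p} {A : Set a} {P : A → Set p} (P? : Decidable P) {m} (xs : Vec A m) i →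
          (∀ r → toℕ r < i → ¬ P (lookup xs r)) →
          ∀ q → i ≤ toℕ q → ¬ P (lookup xs q) → count P? xs < m ∸ i
count<∸ P? (x ∷ xs) i _ Fin.zero z≤n ¬Px with P? x
... | yes Px = contradiction Px ¬Px
... | no _ = s≤s (count≤n P? xs)
count<∸ P? (x ∷ xs) zero _ (Fin.suc q) z≤n ¬Pq with P? x
... | yes _ = s≤s (count<∸ P? xs zero (λ _ ()) q z≤n ¬Pq)
... | no _ = m≤n⇒m≤1+n (count<∸ P? xs zero (λ _ ()) q z≤n ¬Pq)
count<∸ P? (x ∷ xs) (suc i) ¬P-below (Fin.suc q) (s≤s i≤q) ¬Pq with P? x
... | yes Px = contradiction Px (¬P-below Fin.zero z<s)
... | no _ = count<∸ P? xs i (λ r → ¬P-below (Fin.suc r) ∘ s≤s) q i≤q ¬Pq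

count≡∸⇒lookup : ∀ {a p} {A : Set a} {P : A → Set p} (P? : Decidable P) {m} (xs : Vec A m) i →
                 (∀ r → toℕ r < i → ¬ P (lookup xs r)) → count P? xs ≡ m ∸ i →
                 ∀ q → i ≤ toℕ q → P (lookup xs q)
count≡∸⇒lookup P? xs i ¬P-below count≡ q i≤q with P? (lookup xs q)
... | yes Pq = Pq
... | no ¬Pq = contradiction count≡ (<⇒≢ (count<∸ P? xs i ¬P-below q i≤q ¬Pq))

strong⇒2k+1≤ : ∀ {n k i} {F : Vec ℕ k} → IsIndex n k F i → countAbove2k k F ≡ k ∸ i →
               ∀ q → i ≤ toℕ q → 2 * k + 1 ≤ lookup F q
strong⇒2k+1≤ {k = k} {i} {F} (_ , i≤k , F≤Zi , _) =
  count≡∸⇒lookup (2 * k + 1 ≤?_) F i below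
  where
  below : ∀ r → toℕ r < i → ¬ (2 * k + 1 ≤ lookup F r)
  below r r<i = <⇒≱ (begin-strict
    lookup F r     ≤⟨ ≤LC-Z⇒lookup≤ F≤Zi r r<i ⟩
    i + toℕ r      ≤⟨ +-mono-≤ i≤k (≤-trans (<⇒≤ r<i) i≤k) ⟩
    k + k          <⟨ n<1+n (k + k) ⟩
    suc (k + k)    ≡⟨ sym (2k+1≡1+k+k k) ⟩
    2 * k + 1      ∎)
    where open ≤-Reasoning

strongFloor : ℕ → ℕ → ℕ → ℕ
strongFloor k i = piecewise i (λ p → suc (p + p)) (λ p → suc (k + k + (p ∸ i)))

-- indexFloor j is the floor for index suc j, which avoids the truncated i ∸ 1.
indexFloor : ℕ → ℕ → ℕ
indexFloor j = piecewise j (λ q → suc (suc (q + q))) (λ q → suc j + q)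

strongFloor-< : ∀ {k i} → i ≤ k → strongFloor k i Preserves _<_ ⟶ _<_
strongFloor-< {k} {i} i≤k = piecewise-preserves-<
  (λ p<q → s≤s (+-mono-< p<q p<q))
  (λ i≤p p<q → s≤s (+-monoʳ-< (k + k) (∸-monoˡ-< p<q i≤p)))
  (λ p<i _ → let p<k = <-≤-trans p<i i≤k in
              s≤s (<-≤-trans (+-mono-< p<k p<k) (m≤m+n (k + k) _)))

indexFloor-< : ∀ j → indexFloor j Preserves _<_ ⟶ _<_
indexFloor-< j = piecewise-preserves-<
  (λ p<q → s≤s (s≤s (+-mono-< p<q p<q)))
  (λ _ p<q → +-monoʳ-< (suc j) p<q)
  (λ {p} {q} p<j j≤q →
    s≤s (subst (_≤ j + q) (cong suc (+-suc p p)) (+-mono-≤ p<j (<-≤-trans p<j j≤q))))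

strongFloor≤ : ∀ {n k i} {F : Vec ℕ k} → IsKSet n k F → k ≤ n → IsIndex n k F i →
               countAbove2k k F ≡ k ∸ i → ∀ p → strongFloor k i (toℕ p) ≤ lookup F p
strongFloor≤ {k = k} {i} {F} kSet k≤n index strong p =
  piecewise-elim (_≤ lookup F p) (toℕ p) (index⇒1+2p≤ kSet k≤n index p) above
  where
  above : i ≤ toℕ p → suc (k + k + (toℕ p ∸ i)) ≤ lookup F p
  above i≤p = begin
    suc (k + k) + d    ≡⟨ cong (_+ d) (sym (2k+1≡1+k+k k)) ⟩
    2 * k + 1 + d      ≤⟨ +-monoˡ-≤ d (strong⇒2k+1≤ index strong r (≤-reflexive (sym r≡i))) ⟩
    lookup F r + d     ≤⟨ increasing-gap F (proj₁ kSet) r p d r+d≡p ⟩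
    lookup F p         ∎
    where
    open ≤-Reasoning
    d = toℕ p ∸ i
    i<k = ≤-<-trans i≤p (toℕ<n p)
    r = fromℕ< i<k
    r≡i = toℕ-fromℕ< i<k
    r+d≡p : toℕ r + d ≡ toℕ p
    r+d≡p = trans (cong (_+ d) r≡i) (m+[n∸m]≡n i≤p)

indexFloor≤ : ∀ {n k j} {F : Vec ℕ k} → IsKSet n k F → k ≤ n → IsIndex n k F (suc j) →
              ∀ q → indexFloor j (toℕ q) ≤ lookup F q
indexFloor≤ {j = j} {F} kSet k≤n index@(_ , j<k , _) q =
  piecewise-elim (_≤ lookup F q) (toℕ q) (index⇒2+2p≤ kSet k≤n index q ∘ s≤s) above
  where
  above : j ≤ toℕ q → suc j + toℕ q ≤ lookup F q
  above j≤q = begin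
    suc j + toℕ q              ≡⟨ cong (suc j +_) (sym (m+[n∸m]≡n j≤q)) ⟩
    suc j + (j + d)            ≡⟨ cong suc (sym (+-assoc j j d)) ⟩
    suc (j + j) + d            ≡⟨ cong (λ m → suc (m + m) + d) (sym r≡j) ⟩
    suc (toℕ r + toℕ r) + d    ≤⟨ +-monoˡ-≤ d (index⇒1+2p≤ kSet k≤n index r r<1+j) ⟩
    lookup F r + d             ≤⟨ increasing-gap F (proj₁ kSet) r q d r+d≡q ⟩
    lookup F q                 ∎
    where
    open ≤-Reasoning
    d = toℕ q ∸ j
    r = fromℕ< j<k
    r≡j = toℕ-fromℕ< j<k
    r<1+j : toℕ r < suc j
    r<1+j = subst (_< suc j) (sym r≡j) (n<1+n j)
    r+d≡q : toℕ r + d ≡ toℕ q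
    r+d≡q = trans (cong (_+ d) r≡j) (m+[n∸m]≡n j≤q)

strongFloor≢indexFloor : ∀ {k i j} → i ≤ j → j < k → ∀ {p q} → p < k → q < k →
                         strongFloor k i p ≢ indexFloor j q
strongFloor≢indexFloor {k} {i} {j} i≤j j<k {p} {q} p<k q<k =
  piecewise-elim (_≢ indexFloor j q) p
    (λ p<i → piecewise-elim (suc (p + p) ≢_) q
      (λ _ → m+m≢1+n+n p q ∘ suc-injective)
      (λ j≤q → let p<j = <-≤-trans p<i i≤j in
                <⇒≢ (s≤s (+-mono-< p<j (<-≤-trans p<j j≤q)))))
    (λ _ → piecewise-elim (suc (k + k + (p ∸ i)) ≢_) q
      (λ q<j → let q<k = <-trans q<j j<k in
                >⇒≢ (s≤s (≤-trans (subst (_≤ k + k) (cong suc (+-suc q q)) (+-mono-≤ q<k q<k))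
                                  (m≤m+n (k + k) _))))
      (λ _ → >⇒≢ (s≤s (<-≤-trans (+-mono-< j<k q<k) (m≤m+n (k + k) _)))))

tabulate∈ : ∀ {n k} {𝓕 : Family k} {F : Vec ℕ k} → IsLCIF n k 𝓕 → 𝓕 F →
            ∀ {f} → f Preserves _<_ ⟶ _<_ → (∀ p → 1 ≤ f p) →
            (∀ p → f (toℕ p) ≤ lookup F p) → 𝓕 (tabulate (f ∘ toℕ))
tabulate∈ {n} {k} {𝓕} {F} (onN , _ , closed) F∈ {f} f-< f-pos f≤F =
  closed F G F∈ (increasing , bounded)
    (≤LC-lookup λ p → subst (_≤ lookup F p) (sym (Gp≡ p)) (f≤F p))
  where
  G = tabulate (f ∘ toℕ)
  Gp≡ : ∀ p → lookup G p ≡ f (toℕ p)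
  Gp≡ = lookup∘tabulate (f ∘ toℕ)
  increasing : Increasing G
  increasing a b a<b = subst₂ _<_ (sym (Gp≡ a)) (sym (Gp≡ b)) (f-< a<b)
  bounded : ∀ p → 1 ≤ lookup G p × lookup G p ≤ n
  bounded p = subst (λ x → 1 ≤ x × x ≤ n) (sym (Gp≡ p))
                (f-pos (toℕ p) , ≤-trans (f≤F p) (proj₂ (proj₂ (onN F F∈) p)))

strongIndex≮index : ∀ {n k i i'} {𝓕 : Family k} {F F' : Vec ℕ k} → IsLCIF n k 𝓕 → k ≤ n →
                    𝓕 F → IsIndex n k F i → countAbove2k k F ≡ k ∸ i →
                    𝓕 F' → IsIndex n k F' i' → ¬ i < i'
strongIndex≮index {i' = zero} _ _ _ _ _ _ (() , _)
strongIndex≮index {k = k} {i} {suc j} {𝓕} {F} {F'} lcif k≤n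
  F∈ index@(_ , i≤k , _) strong F'∈ index'@(_ , j<k , _) i<i' =
  let x , x∈A , x∈B = proj₁ (proj₂ lcif) _ _ A∈ B∈
      p , x≡Ap = Any.tabulate⁻ x∈A
      q , x≡Bq = Any.tabulate⁻ x∈B
  in strongFloor≢indexFloor (s≤s⁻¹ i<i') j<k (toℕ<n p) (toℕ<n q) (trans (sym x≡Ap) x≡Bq)
  where
  A∈ : 𝓕 (tabulate (strongFloor k i ∘ toℕ))
  A∈ = tabulate∈ lcif F∈ (strongFloor-< i≤k)
         (λ p → piecewise-elim (1 ≤_) p (λ _ → s≤s z≤n) (λ _ → s≤s z≤n))
         (strongFloor≤ (proj₁ lcif F F∈) k≤n index strong)
  B∈ : 𝓕 (tabulate (indexFloor j ∘ toℕ))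
  B∈ = tabulate∈ lcif F'∈ (indexFloor-< j)
         (λ q → piecewise-elim (1 ≤_) q (λ _ → s≤s z≤n) (λ _ → s≤s z≤n))
         (indexFloor≤ (proj₁ lcif F' F'∈) k≤n index')

IsIndex-unique : ∀ {n k i i'} {F : Vec ℕ k} → IsIndex n k F i → IsIndex n k F i' → i ≡ i'
IsIndex-unique (1≤i , _ , F≤Zi , minimal) (1≤i' , _ , F≤Zi' , minimal') = ≤-antisym
  (≮⇒≥ λ i'<i → minimal _ 1≤i' i'<i F≤Zi')
  (≮⇒≥ λ i<i' → minimal' _ 1≤i i<i' F≤Zi)

corollary2p6 : (n k : ℕ) → 2 * k ≤ n → (𝓕 : Family k) → IsMLCIF n k 𝓕 →
    (F F' : Vec ℕ k) → IsStrong n k 𝓕 F → IsStrong n k 𝓕 F' →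
    (i i' : ℕ) → IsIndex n k F i → IsIndex n k F' i' → i ≡ i'
corollary2p6 n k 2k≤n 𝓕 (lcif , _) F F'
  (F∈ , i₀ , index₀ , strong₀) (F'∈ , i₀' , index₀' , strong₀') i i' index index' = begin
  i    ≡⟨ IsIndex-unique index index₀ ⟩
  i₀   ≡⟨ ≤-antisym (≮⇒≥ (strongIndex≮index lcif k≤n F'∈ index₀' strong₀' F∈ index₀))
                    (≮⇒≥ (strongIndex≮index lcif k≤n F∈ index₀ strong₀ F'∈ index₀')) ⟩
  i₀'  ≡⟨ IsIndex-unique index₀' index' ⟩
  i'   ∎
  where
  open Relation.Binary.PropositionalEquality.≡-Reasoning
  k≤n : k ≤ n
  k≤n = ≤-trans (m≤m+n k _) 2k≤n
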